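{- For each integer $r\ge2$ and each positive integer $m$, there is, up to row and column permutations, a unique simple $m$-rowed $r$-matrix $A$ that avoids $I_2$ and has $|A|=\operatorname{forb}(m,r,I_2)$.
   Context: An $r$-matrix is a matrix with entries in $\{0,1,\dots,r-1\}$. A matrix is simple if it has no repeated columns. $I_2$ is the $2\times2$ identity matrix; $A$ avoids $I_2$ if no submatrix of $A$ is a row and column permutation of $I_2$. $|A|$ is the number of columns of $A$, and $\operatorname{forb}(m,r,I_2)$ is the maximum number of columns of a simple $m$-rowed $r$-matrix avoiding $I_2$. -}

module Defs where

open import Data.Nat using (ℕ; _≤_)
open import Data.Fin using (Fin; toℕ)
open import Data.Fin.Permutation using (Permutation′; _⟨$⟩ʳ_)
open import Data.Product using (Σ; ∃; _×_; _,_)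
open import Relation.Binary.PropositionalEquality using (_≡_; _≢_)
open import Relation.Nullary using (¬_)

Matrix : ℕ → ℕ → ℕ → Set
Matrix r m n = Fin m → Fin n → Fin r

Simple : ∀ {r m n} → Matrix r m n → Set
Simple {r} {m} {n} A = ∀ (j k : Fin n) → j ≢ k → ¬ (∀ (i : Fin m) → A i j ≡ A i k)

-- A contains I₂ as a configuration: distinct rows i₁ i₂ and distinct columns
-- j₁ j₂ whose 2×2 submatrix is [[1,0],[0,1]].  (Any row/column permutation
-- of I₂ is I₂ itself or [[0,1],[1,0]]; the latter is covered by swapping j₁ j₂.)
ContainsI₂ : ∀ {r m n} → Matrix r m n → Set
ContainsI₂ {r} {m} {n} A =
  Σ (Fin m) λ i₁ → Σ (Fin m) λ i₂ → Σ (Fin n) λ j₁ → Σ (Fin n) λ j₂ →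
    i₁ ≢ i₂ × j₁ ≢ j₂ ×
    toℕ (A i₁ j₁) ≡ 1 × toℕ (A i₁ j₂) ≡ 0 ×
    toℕ (A i₂ j₁) ≡ 0 × toℕ (A i₂ j₂) ≡ 1

AvoidsI₂ : ∀ {r m n} → Matrix r m n → Set
AvoidsI₂ A = ¬ ContainsI₂ A

IsForbI₂ : ℕ → ℕ → ℕ → Set
IsForbI₂ m r n =
  (Σ (Matrix r m n) λ A → Simple A × AvoidsI₂ A) ×
  (∀ (n′ : ℕ) (B : Matrix r m n′) → Simple B → AvoidsI₂ B → n′ ≤ n)

PermEquiv : ∀ {r m n} → Matrix r m n → Matrix r m n → Set
PermEquiv {r} {m} {n} B A =
  Σ (Permutation′ m) λ σ → Σ (Permutation′ n) λ τ →
    ∀ (i : Fin m) (j : Fin n) → B i j ≡ A (σ ⟨$⟩ʳ i) (τ ⟨$⟩ʳ j)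

module Submission where

-- Write r = s + 2 and q = r - 1, and view an m-rowed r-matrix as a list of
-- columns.  Two columns cross if one row reads (1, 0) and another (0, 1) across
-- them; a simple matrix avoids I₂ iff its columns form an admissible family
-- (distinct and pairwise non-crossing).  Let f 0 = 1 and f (m+1) = q·f m + q^m.
--
-- Split an admissible family of
-- height m + 1 by its top entry.  The tails under each symbol ≥ 2, and the union
-- U of the tails under 0 or 1, are admissible of height m; the tails under both
-- 0 and 1 are mapped injectively, by identifying 1 with 0, into the q^m columns
-- avoiding 1.  Hence the family has at most s·f m + f m + q^m = f (m+1) columns.
--
-- A column is a staircase for a
-- ranking of the rows if all its 1s precede all its 0s.  Staircases never cross,
-- and for a fixed ranking there are exactly f m of them; so forb(m, r, I₂) = f m.
--
-- In an
-- extremal family all the inequalities above are equalities, so U is extremal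
-- and by induction consists of staircases for some ranking; the top row can be
-- inserted into that ranking so that every column becomes a staircase.  An
-- extremal family of staircases is all of them, which identifies the matrix with
-- the staircase matrix up to row and column permutations.

open import Defs
open import Data.Nat using (ℕ; zero; suc; _+_; _*_; _^_; _≤_; _<_; z≤n; s≤s)
import Data.Nat.Properties as ℕ
open import Data.Fin as Fin using (Fin; zero; suc; toℕ; punchIn; fromℕ<)
import Data.Fin.Properties as Fin
open import Data.Fin.Permutation
  using (Permutation′; permutation; _⟨$⟩ʳ_; _⟨$⟩ˡ_; inverseˡ; inverseʳ; insert; insert-punchIn)
  renaming (id to idₚ)
open import Data.List as List using (List; []; _∷_; length; map; filter; _++_; allFin)
open import Data.List.Properties using (length-++; length-map; length-tabulate)
open import Data.List.Extrema.Nat using (min; min≤⊤; min≤v⁺; v<min⁺)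
open import Data.List.Membership.Propositional using (_∈_; lose; find)
open import Data.List.Membership.Propositional.Properties
  using (∈-++⁺ˡ; ∈-++⁺ʳ; ∈-++⁻; ∈-map⁺; ∈-map⁻; ∈-filter⁺; ∈-filter⁻; ∈-allFin; ∈-lookup;
         ∈-tabulate⁺; ∈-tabulate⁻; ∈-cartesianProductWith⁺; ∈-cartesianProductWith⁻)
open import Data.List.Relation.Unary.Any using (Any; here; there; any?; index)
open import Data.List.Relation.Unary.Any.Properties using (lookup-index)
open import Data.List.Relation.Unary.All as All using ([]; _∷_)
import Data.List.Relation.Unary.All.Properties as All
open import Data.List.Relation.Unary.AllPairs using ([]; _∷_)
open import Data.List.Relation.Unary.Unique.Propositional using (Unique)
import Data.List.Relation.Unary.Unique.Propositional.Properties as Unique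
open import Data.Vec as Vec using (Vec; []; _∷_; lookup; tabulate)
import Data.Vec.Properties as Vec
open import Data.Product using (Σ; ∃; _×_; _,_; proj₁; proj₂)
open import Data.Sum using (_⊎_; inj₁; inj₂)
open import Data.Empty using (⊥-elim)
open import Function using (_∘_; id)
open import Relation.Nullary using (¬_; yes; no; ¬?)
open import Relation.Unary using (Pred; Decidable)
open import Relation.Binary.PropositionalEquality
open import Relation.Binary.Definitions using (DecidableEquality; tri<; tri≈; tri>)
open import Algebra.Properties.CommutativeSemigroup ℕ.+-commutativeSemigroup
  using (interchange; x∙yz≈xz∙y; xy∙z≈xz∙y)

private variable A B : Set

vec-ext : ∀ {m} (u w : Vec A m) → (∀ i → lookup u i ≡ lookup w i) → u ≡ w
vec-ext u w same = begin
  u                   ≡⟨ Vec.tabulate∘lookup u ⟨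
  tabulate (lookup u) ≡⟨ Vec.tabulate-cong same ⟩
  tabulate (lookup w) ≡⟨ Vec.tabulate∘lookup w ⟩
  w                   ∎
  where open ≡-Reasoning

module Counting (_≟_ : DecidableEquality A) where

  open import Data.List.Membership.DecPropositional _≟_ using (_∈?_)

  remove : A → List A → List A
  remove x [] = []
  remove x (y ∷ ys) with x ≟ y
  ... | yes _ = ys
  ... | no  _ = y ∷ remove x ys

  length-remove : ∀ {x} ys → x ∈ ys → suc (length (remove x ys)) ≡ length ys
  length-remove {x} (y ∷ ys) x∈ with x ≟ y
  ... | yes _ = refl
  length-remove (y ∷ ys) (here  x≡y) | no x≢y = ⊥-elim (x≢y x≡y)
  length-remove (y ∷ ys) (there x∈) | no _   = cong suc (length-remove ys x∈)

  ∈-remove : ∀ {x z} ys → z ∈ ys → z ≢ x → z ∈ remove x ys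
  ∈-remove {x} (y ∷ ys) z∈ z≢x with x ≟ y
  ∈-remove (y ∷ ys) (here refl) z≢x | yes refl = ⊥-elim (z≢x refl)
  ∈-remove (y ∷ ys) (there z∈)  z≢x | yes _    = z∈
  ∈-remove (y ∷ ys) (here z≡y)  z≢x | no _     = here z≡y
  ∈-remove (y ∷ ys) (there z∈)  z≢x | no _     = there (∈-remove ys z∈ z≢x)

  unique⊆⇒length≤ : ∀ xs ys → Unique xs → (∀ {z} → z ∈ xs → z ∈ ys) →
                    length xs ≤ length ys
  unique⊆⇒length≤ []       ys _ _ = z≤n
  unique⊆⇒length≤ (x ∷ xs) ys (x∉xs ∷ uxs) xs⊆ys =
    subst (suc (length xs) ≤_) (length-remove ys (xs⊆ys (here refl)))
      (s≤s (unique⊆⇒length≤ xs (remove x ys) uxs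
        (λ z∈ → ∈-remove ys (xs⊆ys (there z∈)) (λ { refl → All.lookup x∉xs z∈ refl }))))

  unique⊆∧length≥⇒⊇ : ∀ xs ys → Unique xs → (∀ {z} → z ∈ xs → z ∈ ys) →
                      length ys ≤ length xs → ∀ {y} → y ∈ ys → y ∈ xs
  unique⊆∧length≥⇒⊇ xs ys uxs xs⊆ys ys≤xs {y} y∈ys with y ∈? xs
  ... | yes y∈xs = y∈xs
  ... | no  y∉xs = ⊥-elim (ℕ.<-irrefl refl (begin-strict
      length xs                 ≤⟨ unique⊆⇒length≤ xs (remove y ys) uxs xs⊆ys-y ⟩
      length (remove y ys)      <⟨ ℕ.≤-reflexive (length-remove ys y∈ys) ⟩
      length ys                 ≤⟨ ys≤xs ⟩
      length xs                 ∎))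
    where
    open ℕ.≤-Reasoning
    xs⊆ys-y : ∀ {z} → z ∈ xs → z ∈ remove y ys
    xs⊆ys-y z∈ = ∈-remove ys (xs⊆ys z∈) (λ { refl → y∉xs z∈ })

map-unique : (f : A → B) → ∀ xs → (∀ {x y} → x ∈ xs → y ∈ xs → f x ≡ f y → x ≡ y) →
             Unique xs → Unique (map f xs)
map-unique f []       inj []           = []
map-unique f (x ∷ xs) inj (x∉xs ∷ uxs) =
  All.map⁺ (All.tabulate λ y∈ fx≡fy → All.lookup x∉xs y∈ (inj (here refl) (there y∈) fx≡fy))
  ∷ map-unique f xs (λ p q → inj (there p) (there q)) uxs

length-filter-split : ∀ {p} {P : Pred A p} (P? : Decidable P) → ∀ xs →
                      length xs ≡ length (filter P? xs) + length (filter (¬? ∘ P?) xs)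
length-filter-split P? [] = refl
length-filter-split P? (x ∷ xs) with P? x
... | yes _ = cong suc (length-filter-split P? xs)
... | no  _ = trans (cong suc (length-filter-split P? xs)) (sym (ℕ.+-suc _ _))

cast-injective : ∀ {m n} .(eq : m ≡ n) {j k : Fin m} → Fin.cast eq j ≡ Fin.cast eq k → j ≡ k
cast-injective eq {j} {k} same =
  Fin.toℕ-injective (trans (sym (Fin.toℕ-cast eq j)) (trans (cong toℕ same) (Fin.toℕ-cast eq k)))

lookup-injective : (xs : List A) → Unique xs → ∀ {i j} → List.lookup xs i ≡ List.lookup xs j → i ≡ j
lookup-injective (x ∷ xs) (x∉xs ∷ uxs) {zero}  {zero}  _  = refl
lookup-injective (x ∷ xs) (x∉xs ∷ uxs) {zero}  {suc j} eq = ⊥-elim (All.lookup x∉xs (∈-lookup j) eq)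
lookup-injective (x ∷ xs) (x∉xs ∷ uxs) {suc i} {zero}  eq = ⊥-elim (All.lookup x∉xs (∈-lookup i) (sym eq))
lookup-injective (x ∷ xs) (x∉xs ∷ uxs) {suc i} {suc j} eq = cong suc (lookup-injective xs uxs eq)

+-tight : ∀ {a b a′ b′} → a ≤ a′ → b ≤ b′ → a′ + b′ ≤ a + b → a ≡ a′ × b ≡ b′
+-tight {a} {b} {a′} {b′} a≤ b≤ sum≤ =
    ℕ.≤-antisym a≤ (ℕ.+-cancelʳ-≤ b a′ a (ℕ.≤-trans (ℕ.+-monoʳ-≤ a′ b≤) sum≤))
  , ℕ.≤-antisym b≤ (ℕ.+-cancelˡ-≤ a b′ b (ℕ.≤-trans (ℕ.+-monoˡ-≤ b′ a≤) sum≤))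

sumFin : ∀ {k} → (Fin k → ℕ) → ℕ
sumFin {zero}  g = 0
sumFin {suc k} g = g zero + sumFin (g ∘ suc)

sumFin-cong : ∀ {k} {g h : Fin k → ℕ} → (∀ v → g v ≡ h v) → sumFin g ≡ sumFin h
sumFin-cong {zero}  g≗h = refl
sumFin-cong {suc k} g≗h = cong₂ _+_ (g≗h zero) (sumFin-cong (g≗h ∘ suc))

sumFin-+ : ∀ {k} (g h : Fin k → ℕ) → sumFin (λ v → g v + h v) ≡ sumFin g + sumFin h
sumFin-+ {zero}  g h = refl
sumFin-+ {suc k} g h = trans (cong (g zero + h zero +_) (sumFin-+ (g ∘ suc) (h ∘ suc)))
                             (interchange (g zero) (h zero) (sumFin (g ∘ suc)) (sumFin (h ∘ suc)))

δ : ∀ {k} → Fin k → Fin k → ℕ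
δ zero    zero    = 1
δ zero    (suc _) = 0
δ (suc _) zero    = 0
δ (suc a) (suc v) = δ a v

δ-refl : ∀ {k} (a : Fin k) → δ a a ≡ 1
δ-refl zero    = refl
δ-refl (suc a) = δ-refl a

δ-≢ : ∀ {k} {a v : Fin k} → a ≢ v → δ a v ≡ 0
δ-≢ {a = zero}  {zero}  a≢v = ⊥-elim (a≢v refl)
δ-≢ {a = zero}  {suc v} a≢v = refl
δ-≢ {a = suc a} {zero}  a≢v = refl
δ-≢ {a = suc a} {suc v} a≢v = δ-≢ (a≢v ∘ cong suc)

sumFin-zero : ∀ k → sumFin {k} (λ _ → 0) ≡ 0
sumFin-zero zero    = refl
sumFin-zero (suc k) = sumFin-zero k

sumFin-δ : ∀ {k} (a : Fin k) → sumFin (δ a) ≡ 1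
sumFin-δ {suc k} zero    = cong suc (sumFin-zero k)
sumFin-δ {suc k} (suc a) = sumFin-δ a

sumFin-≤ : ∀ {k} (g : Fin k → ℕ) F → (∀ v → g v ≤ F) → sumFin g ≤ k * F
sumFin-≤ {zero}  g F g≤ = z≤n
sumFin-≤ {suc k} g F g≤ = ℕ.+-mono-≤ (g≤ zero) (sumFin-≤ (g ∘ suc) F (g≤ ∘ suc))

length-cartesianProductWith : ∀ {C : Set} (f : A → B → C) xs ys →
  length (List.cartesianProductWith f xs ys) ≡ length xs * length ys
length-cartesianProductWith f []       ys = refl
length-cartesianProductWith f (x ∷ xs) ys = begin
  length (map (f x) ys ++ List.cartesianProductWith f xs ys)
    ≡⟨ length-++ (map (f x) ys) ⟩
  length (map (f x) ys) + length (List.cartesianProductWith f xs ys)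
    ≡⟨ cong₂ _+_ (length-map (f x) ys) (length-cartesianProductWith f xs ys) ⟩
  length ys + length xs * length ys ∎
  where open ≡-Reasoning

words : List A → ∀ m → List (Vec A m)
words L zero    = [] ∷ []
words L (suc m) = List.cartesianProductWith _∷_ L (words L m)

length-words : (L : List A) → ∀ m → length (words L m) ≡ length L ^ m
length-words L zero    = refl
length-words L (suc m) = trans (length-cartesianProductWith _∷_ L (words L m))
                               (cong (length L *_) (length-words L m))

∈-words⁺ : (L : List A) → ∀ {m} (w : Vec A m) → (∀ i → lookup w i ∈ L) → w ∈ words L m
∈-words⁺ L []      _   = here refl
∈-words⁺ L (a ∷ w) w∈L = ∈-cartesianProductWith⁺ _∷_ (w∈L zero) (∈-words⁺ L w (w∈L ∘ suc))

∈-words⁻ : (L : List A) → ∀ {m} (w : Vec A m) → w ∈ words L m → ∀ i → lookup w i ∈ L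
∈-words⁻ L (a ∷ w) w∈ i with ∈-cartesianProductWith⁻ _∷_ L (words L _) w∈
∈-words⁻ L (a ∷ w) w∈ zero    | _ , _ , a∈ , _  , refl = a∈
∈-words⁻ L (a ∷ w) w∈ (suc i) | _ , _ , _  , w∈′ , refl = ∈-words⁻ L w w∈′ i

words-unique : (L : List A) → Unique L → ∀ m → Unique (words L m)
words-unique L uL zero    = [] ∷ []
words-unique L uL (suc m) = Unique.cartesianProductWith⁺ _∷_ Vec.∷-injective uL (words-unique L uL m)

injective⇒permutation : ∀ {n} (g : Fin n → Fin n) → (∀ {a b} → g a ≡ g b → a ≡ b) →
                        Σ (Permutation′ n) λ π → ∀ i → π ⟨$⟩ʳ i ≡ g i
injective⇒permutation {zero}  g g-inj = permutation g g (λ ()) (λ ()) , λ ()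
injective⇒permutation {suc n} g g-inj =
  permutation g (proj₁ ∘ surjective) (proj₂ ∘ surjective) (λ x → g-inj (proj₂ (surjective (g x))))
  , λ _ → refl
  where
  surjective : ∀ y → Σ (Fin (suc n)) λ a → g a ≡ y
  surjective y with Fin.any? (λ a → g a Fin.≟ y)
  ... | yes hit = hit
  ... | no miss = ⊥-elim (ℕ.<-irrefl refl (Fin.injective⇒≤ squeeze-injective))
    where
    -- g misses y, so it squeezes Fin n injectively into Fin (n - 1)
    squeeze : Fin (suc n) → Fin n
    squeeze a = Fin.punchOut {i = y} (λ y≡ga → miss (a , sym y≡ga))
    squeeze-injective : ∀ {a b} → squeeze a ≡ squeeze b → a ≡ b
    squeeze-injective {a} {b} eq =
      g-inj (Fin.punchOut-injective (λ y≡ga → miss (a , sym y≡ga)) (λ y≡gb → miss (b , sym y≡gb)) eq)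

punchIn-below : ∀ {n} (k : Fin (suc n)) (p : Fin n) → p Fin.< k → punchIn k p Fin.< k
punchIn-below (suc k) zero    _         = s≤s z≤n
punchIn-below (suc k) (suc p) (s≤s p<k) = s≤s (punchIn-below k p p<k)

punchIn-above : ∀ {n} (k : Fin (suc n)) (p : Fin n) → k Fin.≤ p → k Fin.< punchIn k p
punchIn-above zero    p       _         = s≤s z≤n
punchIn-above (suc k) (suc p) (s≤s k≤p) = s≤s (punchIn-above k p k≤p)

punchIn-mono-< : ∀ {n} (k : Fin (suc n)) (a b : Fin n) → a Fin.< b → punchIn k a Fin.< punchIn k b
punchIn-mono-< k a b a<b =
  Fin.≤∧≢⇒< (Fin.punchIn-mono-≤ k a b (ℕ.<⇒≤ a<b)) (Fin.<⇒≢ a<b ∘ Fin.punchIn-injective k a b)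

cutBelow : ∀ {m} (rk : Fin m → Fin m) {q} {Q : Pred (Fin m) q} → Decidable Q →
           Σ (Fin (suc m)) λ K → (∀ i → Q i → K Fin.≤ rk i) ×
                                 (∀ j → (∀ i → Q i → rk j Fin.< rk i) → rk j Fin.< K)
cutBelow {m} rk {Q = Q} Q? = K , K≤Q , below⇒<K
  where
  ranksQ : List ℕ
  ranksQ = map (toℕ ∘ rk) (filter Q? (allFin m))
  K : Fin (suc m)
  K = fromℕ< (s≤s (min≤⊤ m ranksQ))
  K≡min : toℕ K ≡ min m ranksQ
  K≡min = Fin.toℕ-fromℕ< (s≤s (min≤⊤ m ranksQ))
  K≤Q : ∀ i → Q i → K Fin.≤ rk i
  K≤Q i Qi = subst (_≤ toℕ (rk i)) (sym K≡min)
    (min≤v⁺ m ranksQ (inj₂ (lose (∈-map⁺ (toℕ ∘ rk) (∈-filter⁺ Q? (∈-allFin i) Qi)) ℕ.≤-refl)))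
  below⇒<K : ∀ j → (∀ i → Q i → rk j Fin.< rk i) → rk j Fin.< K
  below⇒<K j below = subst (toℕ (rk j) <_) (sym K≡min) (v<min⁺ (Fin.toℕ<n (rk j)) (All.tabulate below-all))
    where
    below-all : ∀ {x} → x ∈ ranksQ → toℕ (rk j) < x
    below-all x∈ with ∈-map⁻ (toℕ ∘ rk) x∈
    ... | i , i∈ , refl = below i (proj₂ (∈-filter⁻ Q? {xs = allFin m} i∈))

-- Throughout, the alphabet is Fin r with r = s + 2, so the symbols 0 and 1 exist.
module ForbiddenI₂ (s : ℕ) where

  r q : ℕ
  r = suc (suc s)
  q = suc s

  e₀ e₁ : Fin r
  e₀ = zero
  e₁ = suc zero

  big : Fin s → Fin r
  big v = suc (suc v)

  bigSymbols : List (Fin r)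
  bigSymbols = map big (allFin s)

  nonOne nonZero : List (Fin r)
  nonOne  = e₀ ∷ bigSymbols
  nonZero = e₁ ∷ bigSymbols

  ∈-bigSymbols : ∀ {a} → a ∈ bigSymbols → Σ (Fin s) λ v → a ≡ big v
  ∈-bigSymbols a∈ with ∈-map⁻ big a∈
  ... | v , _ , a≡ = v , a≡

  ∈-nonOne⁺ : ∀ a → a ≢ e₁ → a ∈ nonOne
  ∈-nonOne⁺ zero           _   = here refl
  ∈-nonOne⁺ (suc zero)     a≢1 = ⊥-elim (a≢1 refl)
  ∈-nonOne⁺ (suc (suc v))  _   = there (∈-map⁺ big (∈-allFin v))

  ∈-nonOne⁻ : ∀ {a} → a ∈ nonOne → a ≢ e₁
  ∈-nonOne⁻ (here refl) ()
  ∈-nonOne⁻ (there a∈) a≡1 with ∈-bigSymbols a∈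
  ∈-nonOne⁻ (there a∈) () | v , refl

  ∈-nonZero⁻ : ∀ {a} → a ∈ nonZero → a ≢ e₀
  ∈-nonZero⁻ (here refl) ()
  ∈-nonZero⁻ (there a∈) a≡0 with ∈-bigSymbols a∈
  ∈-nonZero⁻ (there a∈) () | v , refl

  bigSymbols-unique : Unique bigSymbols
  bigSymbols-unique = Unique.map⁺ (Fin.suc-injective ∘ Fin.suc-injective) (Unique.allFin⁺ s)

  nonOne-unique : Unique nonOne
  nonOne-unique = All.tabulate (λ a∈ 0≡a → ∈-nonZero⁻ (there a∈) (sym 0≡a)) ∷ bigSymbols-unique

  nonZero-unique : Unique nonZero
  nonZero-unique = All.tabulate (λ a∈ 1≡a → ∈-nonOne⁻ (there a∈) (sym 1≡a)) ∷ bigSymbols-unique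

  length-bigSymbols : length bigSymbols ≡ s
  length-bigSymbols = trans (length-map big (allFin s)) (length-tabulate (λ i → i))

  length-nonOne : length nonOne ≡ q
  length-nonOne = cong suc length-bigSymbols

  length-nonZero : length nonZero ≡ q
  length-nonZero = cong suc length-bigSymbols

  -- Two columns c, d cross if (c, d) has a row (1, 0) and
  -- a row (0, 1): then these two rows and columns form a copy of I₂.
  Column : ℕ → Set
  Column m = Vec (Fin r) m

  _≟ᶜ_ : ∀ {m} → DecidableEquality (Column m)
  _≟ᶜ_ = Vec.≡-dec Fin._≟_

  Crossing : ∀ {m} → Column m → Column m → Set
  Crossing c d = (∃ λ i → lookup c i ≡ e₁ × lookup d i ≡ e₀) ×
                 (∃ λ j → lookup c j ≡ e₀ × lookup d j ≡ e₁)

  Admissible : ∀ {m} → List (Column m) → Set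
  Admissible cs = Unique cs × (∀ {c d} → c ∈ cs → d ∈ cs → ¬ Crossing c d)

  forbSize : ℕ → ℕ
  forbSize zero    = 1
  forbSize (suc m) = q * forbSize m + q ^ m

  crossing-∷ : ∀ {m} {c d : Column m} a b → Crossing c d → Crossing (a ∷ c) (b ∷ d)
  crossing-∷ a b ((i , ci , di) , (j , cj , dj)) = (suc i , ci , di) , (suc j , cj , dj)

  tailsWith : ∀ {m} → Fin r → List (Column (suc m)) → List (Column m)
  tailsWith a [] = []
  tailsWith a ((h ∷ c) ∷ cs) with h Fin.≟ a
  ... | yes _ = c ∷ tailsWith a cs
  ... | no  _ = tailsWith a cs

  ∈-tailsWith⁻ : ∀ {m a c} (cs : List (Column (suc m))) → c ∈ tailsWith a cs → (a ∷ c) ∈ cs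
  ∈-tailsWith⁻ {a = a} ((h ∷ c) ∷ cs) c∈ with h Fin.≟ a
  ∈-tailsWith⁻ ((h ∷ c) ∷ cs) (here refl) | yes refl = here refl
  ∈-tailsWith⁻ ((h ∷ c) ∷ cs) (there c∈)  | yes _    = there (∈-tailsWith⁻ cs c∈)
  ∈-tailsWith⁻ ((h ∷ c) ∷ cs) c∈          | no  _    = there (∈-tailsWith⁻ cs c∈)

  ∈-tailsWith⁺ : ∀ {m a c} (cs : List (Column (suc m))) → (a ∷ c) ∈ cs → c ∈ tailsWith a cs
  ∈-tailsWith⁺ {a = a} ((h ∷ c) ∷ cs) ac∈ with h Fin.≟ a
  ∈-tailsWith⁺ ((h ∷ c) ∷ cs) (here refl) | yes _  = here refl
  ∈-tailsWith⁺ ((h ∷ c) ∷ cs) (there ac∈) | yes _  = there (∈-tailsWith⁺ cs ac∈)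
  ∈-tailsWith⁺ ((h ∷ c) ∷ cs) (here refl) | no h≢a = ⊥-elim (h≢a refl)
  ∈-tailsWith⁺ ((h ∷ c) ∷ cs) (there ac∈) | no _   = ∈-tailsWith⁺ cs ac∈

  tailsWith-unique : ∀ {m a} (cs : List (Column (suc m))) → Unique cs → Unique (tailsWith a cs)
  tailsWith-unique [] _ = []
  tailsWith-unique {a = a} ((h ∷ c) ∷ cs) (c∉ ∷ ucs) with h Fin.≟ a
  ... | yes refl = All.tabulate (λ d∈ c≡d → All.lookup c∉ (∈-tailsWith⁻ cs d∈) (cong (h ∷_) c≡d))
                   ∷ tailsWith-unique cs ucs
  ... | no _     = tailsWith-unique cs ucs

  tailsWith-admissible : ∀ {m} a (cs : List (Column (suc m))) → Admissible cs → Admissible (tailsWith a cs)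
  tailsWith-admissible a cs (ucs , nc) =
    tailsWith-unique cs ucs , λ c∈ d∈ → nc (∈-tailsWith⁻ cs c∈) (∈-tailsWith⁻ cs d∈) ∘ crossing-∷ a a

  length-tailsWith-∷ : ∀ {m} a h (c : Column m) cs →
                       length (tailsWith a ((h ∷ c) ∷ cs)) ≡ δ h a + length (tailsWith a cs)
  length-tailsWith-∷ a h c cs with h Fin.≟ a
  ... | yes refl = cong (_+ length (tailsWith h cs)) (sym (δ-refl h))
  ... | no  h≢a  = cong (_+ length (tailsWith a cs)) (sym (δ-≢ h≢a))

  length-by-top : ∀ {m} (cs : List (Column (suc m))) → length cs ≡ sumFin (λ a → length (tailsWith a cs))
  length-by-top []             = sym (sumFin-zero r)
  length-by-top ((h ∷ c) ∷ cs) = sym (begin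
    sumFin (λ a → length (tailsWith a ((h ∷ c) ∷ cs)))
      ≡⟨ sumFin-cong (λ a → length-tailsWith-∷ a h c cs) ⟩
    sumFin (λ a → δ h a + length (tailsWith a cs))
      ≡⟨ sumFin-+ (δ h) (λ a → length (tailsWith a cs)) ⟩
    sumFin (δ h) + sumFin (λ a → length (tailsWith a cs))
      ≡⟨ cong₂ _+_ (sumFin-δ h) (sym (length-by-top cs)) ⟩
    suc (length cs) ∎)
    where open ≡-Reasoning

  merge₀₁ : Fin r → Fin r
  merge₀₁ (suc zero) = e₀
  merge₀₁ a          = a

  merge₀₁-nonOne : ∀ a → merge₀₁ a ∈ nonOne
  merge₀₁-nonOne a = ∈-nonOne⁺ (merge₀₁ a) (lemma a)
    where
    lemma : ∀ a → merge₀₁ a ≢ e₁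
    lemma zero          ()
    lemma (suc zero)    ()
    lemma (suc (suc v)) ()

  merge₀₁-zero : ∀ a → merge₀₁ a ≡ e₀ → a ≡ e₀ ⊎ a ≡ e₁
  merge₀₁-zero zero       _ = inj₁ refl
  merge₀₁-zero (suc zero) _ = inj₂ refl

  merge₀₁-collision : ∀ a b → merge₀₁ a ≡ merge₀₁ b → a ≢ b →
                      (a ≡ e₀ × b ≡ e₁) ⊎ (a ≡ e₁ × b ≡ e₀)
  merge₀₁-collision zero          zero          _  a≢b = ⊥-elim (a≢b refl)
  merge₀₁-collision zero          (suc zero)    _  _   = inj₁ (refl , refl)
  merge₀₁-collision (suc zero)    zero          _  _   = inj₂ (refl , refl)
  merge₀₁-collision (suc zero)    (suc zero)    _  a≢b = ⊥-elim (a≢b refl)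
  merge₀₁-collision (suc (suc v)) (suc (suc w)) eq a≢b = ⊥-elim (a≢b eq)

  mergeᶜ : ∀ {m} → Column m → Column m
  mergeᶜ = Vec.map merge₀₁

  mergeᶜ-collision : ∀ {m} (c d : Column m) → mergeᶜ c ≡ mergeᶜ d → c ≢ d →
                     ∃ λ i → (lookup c i ≡ e₀ × lookup d i ≡ e₁) ⊎
                             (lookup c i ≡ e₁ × lookup d i ≡ e₀)
  mergeᶜ-collision {m} c d same c≢d with Fin.¬∀⟶∃¬ m (λ i → lookup c i ≡ lookup d i)
                                          (λ i → lookup c i Fin.≟ lookup d i) (c≢d ∘ vec-ext c d)
  ... | i , ci≢di = i , merge₀₁-collision (lookup c i) (lookup d i) merged ci≢di
    where
    merged : merge₀₁ (lookup c i) ≡ merge₀₁ (lookup d i)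
    merged = trans (sym (Vec.lookup-map i merge₀₁ c))
               (trans (cong (λ w → lookup w i) same) (Vec.lookup-map i merge₀₁ d))

  mergeᶜ-words : ∀ {m} (c : Column m) → mergeᶜ c ∈ words nonOne m
  mergeᶜ-words c = ∈-words⁺ nonOne (mergeᶜ c)
    (λ i → subst (_∈ nonOne) (sym (Vec.lookup-map i merge₀₁ c)) (merge₀₁-nonOne (lookup c i)))

  -- The tails under a symbol ≥ 2 form s admissible families; the tails under 0
  -- or 1 form one admissible family U; and the tails under both 0 and 1 are
  -- mapped injectively by mergeᶜ into the q ^ m columns avoiding the symbol 1.
  module TopRowSplit {m} (bound : ∀ (cs : List (Column m)) → Admissible cs → length cs ≤ forbSize m)
                     (cs : List (Column (suc m))) (adm : Admissible cs) where

    open Counting (_≟ᶜ_ {m})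
    open import Data.List.Membership.DecPropositional (_≟ᶜ_ {m}) using (_∈?_)

    T₀ T₁ both only₁ U : List (Column m)
    T₀    = tailsWith e₀ cs
    T₁    = tailsWith e₁ cs
    both  = filter (_∈? T₀) T₁
    only₁ = filter (¬? ∘ (_∈? T₀)) T₁
    U     = T₀ ++ only₁

    noCrossing : ∀ {c d} → c ∈ cs → d ∈ cs → ¬ Crossing c d
    noCrossing = proj₂ adm

    tails-unique : ∀ {a} → Unique (tailsWith a cs)
    tails-unique = tailsWith-unique cs (proj₁ adm)

    U-lift : ∀ {c} → c ∈ U → Σ (Fin r) λ a → (a ∷ c) ∈ cs
    U-lift c∈ with ∈-++⁻ T₀ c∈
    ... | inj₁ c∈T₀ = e₀ , ∈-tailsWith⁻ cs c∈T₀
    ... | inj₂ c∈   = e₁ , ∈-tailsWith⁻ cs (proj₁ (∈-filter⁻ (¬? ∘ (_∈? T₀)) {xs = T₁} c∈))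

    T₁⊆U : ∀ {c} → c ∈ T₁ → c ∈ U
    T₁⊆U {c} c∈T₁ with c ∈? T₀
    ... | yes c∈T₀ = ∈-++⁺ˡ c∈T₀
    ... | no  c∉T₀ = ∈-++⁺ʳ T₀ (∈-filter⁺ (¬? ∘ (_∈? T₀)) c∈T₁ c∉T₀)

    U-admissible : Admissible U
    U-admissible =
        Unique.++⁺ tails-unique (Unique.filter⁺ (¬? ∘ (_∈? T₀)) tails-unique)
          (λ (c∈T₀ , c∈only₁) → proj₂ (∈-filter⁻ (¬? ∘ (_∈? T₀)) {xs = T₁} c∈only₁) c∈T₀)
      , λ c∈ d∈ → noCrossing (proj₂ (U-lift c∈)) (proj₂ (U-lift d∈)) ∘ crossing-∷ _ _

    ∈-both⁻ : ∀ {c} → c ∈ both → (e₀ ∷ c) ∈ cs × (e₁ ∷ c) ∈ cs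
    ∈-both⁻ c∈ with ∈-filter⁻ (_∈? T₀) {xs = T₁} c∈
    ... | c∈T₁ , c∈T₀ = ∈-tailsWith⁻ cs c∈T₀ , ∈-tailsWith⁻ cs c∈T₁

    -- Two columns of both merging to the same column would yield, together with
    -- the top row, a crossing in cs.
    mergeᶜ-injective-both : ∀ {c d} → c ∈ both → d ∈ both → mergeᶜ c ≡ mergeᶜ d → c ≡ d
    mergeᶜ-injective-both {c} {d} c∈ d∈ same with c ≟ᶜ d
    ... | yes c≡d = c≡d
    ... | no  c≢d with mergeᶜ-collision c d same c≢d
    ... | i , inj₁ (ci≡0 , di≡1) = ⊥-elim (noCrossing (proj₂ (∈-both⁻ c∈)) (proj₁ (∈-both⁻ d∈))
                                                      ((zero , refl , refl) , (suc i , ci≡0 , di≡1)))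
    ... | i , inj₂ (ci≡1 , di≡0) = ⊥-elim (noCrossing (proj₁ (∈-both⁻ c∈)) (proj₂ (∈-both⁻ d∈))
                                                      ((suc i , ci≡1 , di≡0) , (zero , refl , refl)))

    merged-both-unique : Unique (map mergeᶜ both)
    merged-both-unique = map-unique mergeᶜ both mergeᶜ-injective-both
                                    (Unique.filter⁺ (_∈? T₀) tails-unique)

    merged-both⊆words : ∀ {w} → w ∈ map mergeᶜ both → w ∈ words nonOne m
    merged-both⊆words w∈ with ∈-map⁻ mergeᶜ w∈
    ... | c , _ , refl = mergeᶜ-words c

    length-words-nonOne : length (words nonOne m) ≡ q ^ m
    length-words-nonOne = trans (length-words nonOne m) (cong (_^ m) length-nonOne)

    length-both≤ : length both ≤ q ^ m
    length-both≤ = subst₂ _≤_ (length-map mergeᶜ both) length-words-nonOne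
                     (unique⊆⇒length≤ (map mergeᶜ both) (words nonOne m) merged-both-unique merged-both⊆words)

    length-T₀+T₁ : length T₀ + length T₁ ≡ length U + length both
    length-T₀+T₁ = begin
      length T₀ + length T₁                    ≡⟨ cong (length T₀ +_) (length-filter-split (_∈? T₀) T₁) ⟩
      length T₀ + (length both + length only₁) ≡⟨ x∙yz≈xz∙y (length T₀) (length both) (length only₁) ⟩
      length T₀ + length only₁ + length both   ≡⟨ cong (_+ length both) (length-++ T₀) ⟨
      length U + length both                   ∎
      where open ≡-Reasoning

    higher : ℕ
    higher = sumFin (λ v → length (tailsWith (big v) cs))

    higher≤ : higher ≤ s * forbSize m
    higher≤ = sumFin-≤ _ (forbSize m) (λ v → bound _ (tailsWith-admissible (big v) cs adm))

    length-cs : length cs ≡ (length U + length both) + higher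
    length-cs = begin
      length cs                                 ≡⟨ length-by-top cs ⟩
      length T₀ + (length T₁ + higher)          ≡⟨ ℕ.+-assoc (length T₀) (length T₁) higher ⟨
      length T₀ + length T₁ + higher            ≡⟨ cong (_+ higher) length-T₀+T₁ ⟩
      length U + length both + higher           ∎
      where open ≡-Reasoning

    bound-split : forbSize m + q ^ m + s * forbSize m ≡ forbSize (suc m)
    bound-split = xy∙z≈xz∙y (forbSize m) (q ^ m) (s * forbSize m)

    length≤ : length cs ≤ forbSize (suc m)
    length≤ = begin
      length cs                                      ≡⟨ length-cs ⟩
      length U + length both + higher
        ≤⟨ ℕ.+-mono-≤ (ℕ.+-mono-≤ (bound U U-admissible) length-both≤) higher≤ ⟩
      forbSize m + q ^ m + s * forbSize m            ≡⟨ bound-split ⟩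
      forbSize (suc m)                               ∎
      where open ℕ.≤-Reasoning

    module Extremal (extremal : length cs ≡ forbSize (suc m)) where

      private
        U+both : length U + length both ≡ forbSize m + q ^ m
        U+both = proj₁ (+-tight (ℕ.+-mono-≤ (bound U U-admissible) length-both≤) higher≤
                                (ℕ.≤-reflexive (trans bound-split (trans (sym extremal) length-cs))))

        tight : length U ≡ forbSize m × length both ≡ q ^ m
        tight = +-tight (bound U U-admissible) length-both≤ (ℕ.≤-reflexive (sym U+both))

      length-U : length U ≡ forbSize m
      length-U = proj₁ tight

      length-both : length both ≡ q ^ m
      length-both = proj₂ tight

  admissible-length≤ : ∀ m (cs : List (Column m)) → Admissible cs → length cs ≤ forbSize m
  admissible-length≤ zero    cs adm =
    Counting.unique⊆⇒length≤ _≟ᶜ_ cs ([] ∷ []) (proj₁ adm) (λ { {[]} _ → here refl })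
  admissible-length≤ (suc m) cs adm = TopRowSplit.length≤ (admissible-length≤ m) cs adm

  Staircase : ∀ {m} → (Fin m → Fin m) → Column m → Set
  Staircase π c = ∀ i j → lookup c i ≡ e₁ → lookup c j ≡ e₀ → π i Fin.< π j

  staircase-noCrossing : ∀ {m} {π : Fin m → Fin m} {c d} → Staircase π c → Staircase π d → ¬ Crossing c d
  staircase-noCrossing c↗ d↗ ((i , ci≡1 , di≡0) , (j , cj≡0 , dj≡1)) =
    Fin.<-asym (c↗ i j ci≡1 cj≡0) (d↗ j i dj≡1 di≡0)

  staircase-∷ : ∀ {m} h (c : Column m) → Staircase id c → (h ≡ e₀ → ∀ j → lookup c j ≢ e₁) →
                Staircase id (h ∷ c)
  staircase-∷ h c c↗ zero-then-no-1 zero    zero    h≡1  h≡0  with trans (sym h≡1) h≡0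
  ... | ()
  staircase-∷ h c c↗ zero-then-no-1 zero    (suc j) h≡1  cj≡0 = s≤s z≤n
  staircase-∷ h c c↗ zero-then-no-1 (suc i) zero    ci≡1 h≡0  = ⊥-elim (zero-then-no-1 h≡0 i ci≡1)
  staircase-∷ h c c↗ zero-then-no-1 (suc i) (suc j) ci≡1 cj≡0 = s≤s (c↗ i j ci≡1 cj≡0)

  staircase-tail : ∀ {m} h (c : Column m) → Staircase id (h ∷ c) → Staircase id c
  staircase-tail h c hc↗ i j ci≡1 cj≡0 = ℕ.≤-pred (hc↗ (suc i) (suc j) ci≡1 cj≡0)

  -- The staircases for the natural order of rows: a staircase of height m + 1
  -- is a nonzero top entry above a staircase, or a top entry 0 above a column
  -- without entries 1.  There are forbSize m of them.
  staircases : ∀ m → List (Column m)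
  staircases zero    = [] ∷ []
  staircases (suc m) = List.cartesianProductWith _∷_ nonZero (staircases m) ++ map (e₀ ∷_) (words nonOne m)

  length-staircases : ∀ m → length (staircases m) ≡ forbSize m
  length-staircases zero    = refl
  length-staircases (suc m) = begin
    length (List.cartesianProductWith _∷_ nonZero (staircases m) ++ map (e₀ ∷_) (words nonOne m))
      ≡⟨ length-++ (List.cartesianProductWith _∷_ nonZero (staircases m)) ⟩
    length (List.cartesianProductWith _∷_ nonZero (staircases m)) + length (map (e₀ ∷_) (words nonOne m))
      ≡⟨ cong₂ _+_ (length-cartesianProductWith _∷_ nonZero (staircases m))
                   (length-map (e₀ ∷_) (words nonOne m)) ⟩
    length nonZero * length (staircases m) + length (words nonOne m)
      ≡⟨ cong₂ _+_ (cong₂ _*_ length-nonZero (length-staircases m))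
                   (trans (length-words nonOne m) (cong (_^ m) length-nonOne)) ⟩
    q * forbSize m + q ^ m ∎
    where open ≡-Reasoning

  ∈-staircases⁻ : ∀ m {c} → c ∈ staircases m → Staircase id c
  ∈-staircases⁻ (suc m) {h ∷ c} hc∈ with ∈-++⁻ (List.cartesianProductWith _∷_ nonZero (staircases m)) hc∈
  ... | inj₁ hc∈′ with ∈-cartesianProductWith⁻ _∷_ nonZero (staircases m) hc∈′
  ...   | _ , _ , h∈ , c∈ , refl = staircase-∷ h c (∈-staircases⁻ m c∈) (⊥-elim ∘ ∈-nonZero⁻ h∈)
  ∈-staircases⁻ (suc m) {h ∷ c} hc∈ | inj₂ hc∈′ with ∈-map⁻ (e₀ ∷_) hc∈′
  ...   | _ , c∈ , refl = staircase-∷ h c (λ i j ci≡1 _ → ⊥-elim (no-1 i ci≡1)) (λ _ → no-1)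
    where
    no-1 : ∀ j → lookup c j ≢ e₁
    no-1 = ∈-nonOne⁻ ∘ ∈-words⁻ nonOne c c∈

  ∈-staircases⁺ : ∀ m {c} → Staircase id c → c ∈ staircases m
  ∈-staircases⁺ zero    {[]}    _ = here refl
  ∈-staircases⁺ (suc m) {h ∷ c} hc↗ with h
  ... | zero = ∈-++⁺ʳ (List.cartesianProductWith _∷_ nonZero (staircases m))
                 (∈-map⁺ (e₀ ∷_) (∈-words⁺ nonOne c
                   (λ j → ∈-nonOne⁺ _ (λ cj≡1 → ℕ.n≮0 (hc↗ (suc j) zero cj≡1 refl)))))
  ... | suc zero    = ∈-++⁺ˡ (∈-cartesianProductWith⁺ _∷_ {xs = nonZero} (here refl)
                                (∈-staircases⁺ m (staircase-tail _ c hc↗)))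
  ... | suc (suc v) = ∈-++⁺ˡ (∈-cartesianProductWith⁺ _∷_ {xs = nonZero} (there (∈-map⁺ big (∈-allFin v)))
                                (∈-staircases⁺ m (staircase-tail _ c hc↗)))

  staircases-unique : ∀ m → Unique (staircases m)
  staircases-unique zero    = [] ∷ []
  staircases-unique (suc m) =
    Unique.++⁺ (Unique.cartesianProductWith⁺ _∷_ Vec.∷-injective nonZero-unique (staircases-unique m))
               (Unique.map⁺ Vec.∷-injectiveʳ (words-unique nonOne nonOne-unique m))
               disjoint
    where
    disjoint : ∀ {c} → ¬ (c ∈ List.cartesianProductWith _∷_ nonZero (staircases m) ×
                          c ∈ map (e₀ ∷_) (words nonOne m))
    disjoint (c∈₁ , c∈₂)
      with ∈-cartesianProductWith⁻ _∷_ nonZero (staircases m) c∈₁ | ∈-map⁻ (e₀ ∷_) c∈₂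
    ... | _ , _ , h∈ , _ , refl | _ , _ , hc≡ = ∈-nonZero⁻ h∈ (Vec.∷-injectiveˡ hc≡)

  -- A staircase for the
  -- ranking ρ becomes a staircase for the natural order when the rows are
  -- put back in ρ-order, so the staircases for ρ are the rearranged staircases.
  module RowPermutation {m} (ρ : Permutation′ m) where

    permuteRows unpermuteRows : Column m → Column m
    permuteRows   c = Vec.tabulate (λ i → lookup c (ρ ⟨$⟩ʳ i))
    unpermuteRows c = Vec.tabulate (λ k → lookup c (ρ ⟨$⟩ˡ k))

    lookup-unpermuteRows : ∀ c k → lookup (unpermuteRows c) k ≡ lookup c (ρ ⟨$⟩ˡ k)
    lookup-unpermuteRows c k = Vec.lookup∘tabulate _ k

    permute-unpermute : ∀ c → permuteRows (unpermuteRows c) ≡ c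
    permute-unpermute c = vec-ext _ c λ i → begin
      lookup (permuteRows (unpermuteRows c)) i ≡⟨ Vec.lookup∘tabulate _ i ⟩
      lookup (unpermuteRows c) (ρ ⟨$⟩ʳ i)      ≡⟨ lookup-unpermuteRows c (ρ ⟨$⟩ʳ i) ⟩
      lookup c (ρ ⟨$⟩ˡ (ρ ⟨$⟩ʳ i))             ≡⟨ cong (lookup c) (inverseˡ ρ) ⟩
      lookup c i                               ∎
      where open ≡-Reasoning

    staircase-unpermuteRows : ∀ {c} → Staircase (ρ ⟨$⟩ʳ_) c → Staircase id (unpermuteRows c)
    staircase-unpermuteRows {c} c↗ k l ck≡1 cl≡0 =
      subst₂ Fin._<_ (inverseʳ ρ) (inverseʳ ρ)
        (c↗ (ρ ⟨$⟩ˡ k) (ρ ⟨$⟩ˡ l) (trans (sym (lookup-unpermuteRows c k)) ck≡1)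
                                 (trans (sym (lookup-unpermuteRows c l)) cl≡0))

    staircasesFor : List (Column m)
    staircasesFor = map permuteRows (staircases m)

    ∈-staircasesFor : ∀ {c} → Staircase (ρ ⟨$⟩ʳ_) c → c ∈ staircasesFor
    ∈-staircasesFor {c} c↗ = subst (_∈ staircasesFor) (permute-unpermute c)
      (∈-map⁺ permuteRows (∈-staircases⁺ m {unpermuteRows c} (staircase-unpermuteRows {c} c↗)))

    staircase-saturated : ∀ (cs : List (Column m)) → Admissible cs → length cs ≡ forbSize m →
                          (∀ {c} → c ∈ cs → Staircase (ρ ⟨$⟩ʳ_) c) →
                          ∀ {c} → Staircase (ρ ⟨$⟩ʳ_) c → c ∈ cs
    staircase-saturated cs adm extremal cs↗ c↗ =
      Counting.unique⊆∧length≥⇒⊇ _≟ᶜ_ cs staircasesFor (proj₁ adm) (∈-staircasesFor ∘ cs↗)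
        (ℕ.≤-reflexive (trans (length-map permuteRows (staircases m))
                              (trans (length-staircases m) (sym extremal))))
        (∈-staircasesFor c↗)

  probeEntry : ∀ {m} → Fin s → Fin m → Fin m → Fin m → Fin r
  probeEntry v i j k with k Fin.≟ j | k Fin.≟ i
  ... | yes _ | _     = e₁
  ... | no  _ | yes _ = e₀
  ... | no  _ | no  _ = big v

  probe : ∀ {m} → Fin s → Fin m → Fin m → Column m
  probe v i j = Vec.tabulate (probeEntry v i j)

  probe-j : ∀ {m} v (i j : Fin m) → lookup (probe v i j) j ≡ e₁
  probe-j v i j rewrite Vec.lookup∘tabulate (probeEntry v i j) j with j Fin.≟ j
  ... | yes _   = refl
  ... | no  j≢j = ⊥-elim (j≢j refl)

  probe-i : ∀ {m} v (i j : Fin m) → i ≢ j → lookup (probe v i j) i ≡ e₀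
  probe-i v i j i≢j rewrite Vec.lookup∘tabulate (probeEntry v i j) i with i Fin.≟ j | i Fin.≟ i
  ... | yes i≡j | _       = ⊥-elim (i≢j i≡j)
  ... | no  _   | yes _   = refl
  ... | no  _   | no  i≢i = ⊥-elim (i≢i refl)

  probe-1 : ∀ {m} v (i j k : Fin m) → lookup (probe v i j) k ≡ e₁ → k ≡ j
  probe-1 v i j k is1 rewrite Vec.lookup∘tabulate (probeEntry v i j) k with k Fin.≟ j | k Fin.≟ i | is1
  ... | yes k≡j | _     | _  = k≡j
  ... | no  _   | yes _ | ()
  ... | no  _   | no  _ | ()

  probe-0 : ∀ {m} v (i j k : Fin m) → lookup (probe v i j) k ≡ e₀ → k ≡ i
  probe-0 v i j k is0 rewrite Vec.lookup∘tabulate (probeEntry v i j) k with k Fin.≟ j | k Fin.≟ i | is0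
  ... | yes _ | _       | ()
  ... | no  _ | yes k≡i | _  = k≡i
  ... | no  _ | no  _   | ()

  probe-staircase : ∀ {m} v (π : Fin m → Fin m) {i j} → π j Fin.< π i → Staircase π (probe v i j)
  probe-staircase v π {i} {j} j<i k l k-is-1 l-is-0
    rewrite probe-1 v i j k k-is-1 | probe-0 v i j l l-is-0 = j<i

  -- Let cs be an extremal family of height
  -- m + 1 and ρ′ a ranking for which all of U (the tails under 0 and 1) are
  -- staircases; U is extremal, so it contains every staircase for ρ′.  Then:
  -- the tails under symbols ≥ 2 are staircases too (else they cross a probe);
  -- a row where a tail under 1 has a 0 ranks after every row where a tail
  -- under 0 has a 1 (using a 0/1 column occurring under both 0 and 1); so the
  -- top row can be inserted into ρ′ between these two sets of rows.
  module InsertTopRow {m} (cs : List (Column (suc m))) (adm : Admissible cs)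
                      (extremal : length cs ≡ forbSize (suc m))
                      (ρ′ : Permutation′ m)
                      (U↗ : ∀ {c} → c ∈ TopRowSplit.U (admissible-length≤ m) cs adm →
                                    Staircase (ρ′ ⟨$⟩ʳ_) c) where

    open TopRowSplit (admissible-length≤ m) cs adm
    open Extremal extremal

    rank : Fin m → Fin m
    rank = ρ′ ⟨$⟩ʳ_

    rank-injective : ∀ {i j} → rank i ≡ rank j → i ≡ j
    rank-injective {i} {j} same = trans (sym (inverseˡ ρ′)) (trans (cong (ρ′ ⟨$⟩ˡ_) same) (inverseˡ ρ′))

    U-saturated : ∀ {c} → Staircase rank c → c ∈ U
    U-saturated = RowPermutation.staircase-saturated ρ′ U U-admissible length-U U↗

    -- The merged columns of both are all q ^ m columns without 1, so 0⋯0 is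
    -- one of them.
    zeros∈merged-both : Vec.replicate m e₀ ∈ map mergeᶜ both
    zeros∈merged-both =
      Counting.unique⊆∧length≥⇒⊇ _≟ᶜ_ (map mergeᶜ both) (words nonOne m) merged-both-unique merged-both⊆words
        (ℕ.≤-reflexive (trans length-words-nonOne (trans (sym length-both) (sym (length-map mergeᶜ both)))))
        (∈-words⁺ nonOne _ (λ i → subst (_∈ nonOne) (sym (Vec.lookup-replicate i e₀)) (here refl)))

    binary : Σ (Column m) λ x → x ∈ both × (∀ i → lookup x i ≡ e₀ ⊎ lookup x i ≡ e₁)
    binary with ∈-map⁻ mergeᶜ zeros∈merged-both
    ... | x , x∈ , zeros≡ = x , x∈ , λ i → merge₀₁-zero (lookup x i) (begin
      merge₀₁ (lookup x i)          ≡⟨ Vec.lookup-map i merge₀₁ x ⟨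
      lookup (mergeᶜ x) i           ≡⟨ cong (λ w → lookup w i) zeros≡ ⟨
      lookup (Vec.replicate m e₀) i ≡⟨ Vec.lookup-replicate i e₀ ⟩
      e₀                            ∎)
      where open ≡-Reasoning

    x : Column m
    x = proj₁ binary

    x-binary : ∀ i → lookup x i ≡ e₀ ⊎ lookup x i ≡ e₁
    x-binary = proj₂ (proj₂ binary)

    x-under-0 : (e₀ ∷ x) ∈ cs
    x-under-0 = proj₁ (∈-both⁻ (proj₁ (proj₂ binary)))

    x-under-1 : (e₁ ∷ x) ∈ cs
    x-under-1 = proj₂ (∈-both⁻ (proj₁ (proj₂ binary)))

    x↗ : Staircase rank x
    x↗ = U↗ (∈-++⁺ˡ (∈-tailsWith⁺ cs x-under-0))

    -- A row i where a column under 1 has a 0 ranks after every row j where a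
    -- column under 0 has a 1: otherwise one of these columns crosses x.
    zeros-after-ones : ∀ {c d} i j → (e₁ ∷ c) ∈ cs → lookup c i ≡ e₀ →
                       (e₀ ∷ d) ∈ cs → lookup d j ≡ e₁ → rank j Fin.< rank i
    zeros-after-ones {c} {d} i j c∈ ci≡0 d∈ dj≡1 with Fin.<-cmp (rank j) (rank i)
    ... | tri< j<i _ _ = j<i
    ... | tri≈ _ j≡i _ with rank-injective j≡i
    ...   | refl = ⊥-elim (noCrossing c∈ d∈ ((zero , refl , refl) , (suc i , ci≡0 , dj≡1)))
    zeros-after-ones {c} {d} i j c∈ ci≡0 d∈ dj≡1 | tri> _ _ i<j with x-binary i | x-binary j
    ... | inj₂ xi≡1 | _         = ⊥-elim (noCrossing c∈ x-under-0 ((zero , refl , refl) , (suc i , ci≡0 , xi≡1)))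
    ... | inj₁ xi≡0 | inj₂ xj≡1 = ⊥-elim (Fin.<-asym i<j (x↗ j i xj≡1 xi≡0))
    ... | inj₁ _    | inj₁ xj≡0 = ⊥-elim (noCrossing d∈ x-under-1 ((suc j , dj≡1 , xj≡0) , (zero , refl , refl)))

    ZeroUnder1 : Fin m → Set
    ZeroUnder1 i = Any (λ c → lookup c i ≡ e₀) T₁

    -- the position of the top row in the new ranking
    cut : Σ (Fin (suc m)) λ K → (∀ i → ZeroUnder1 i → K Fin.≤ rank i) ×
                                (∀ j → (∀ i → ZeroUnder1 i → rank j Fin.< rank i) → rank j Fin.< K)
    cut = cutBelow rank (λ i → any? (λ c → lookup c i Fin.≟ e₀) T₁)

    K : Fin (suc m)
    K = proj₁ cut

    K≤zero-under-1 : ∀ {c} i → (e₁ ∷ c) ∈ cs → lookup c i ≡ e₀ → K Fin.≤ rank i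
    K≤zero-under-1 i c∈ ci≡0 = proj₁ (proj₂ cut) i (lose (∈-tailsWith⁺ cs c∈) ci≡0)

    one-under-0<K : ∀ {d} j → (e₀ ∷ d) ∈ cs → lookup d j ≡ e₁ → rank j Fin.< K
    one-under-0<K j d∈ dj≡1 = proj₂ (proj₂ cut) j λ i zero-under-1 →
      let (c , c∈ , ci≡0) = find zero-under-1 in zeros-after-ones i j (∈-tailsWith⁻ cs c∈) ci≡0 d∈ dj≡1

    -- Tails under symbols ≥ 2 are staircases for ρ′ as well: a violation in
    -- rows i, j would make the column cross the probe with 1 in j and 0 in i,
    -- which is a staircase for ρ′ and hence lies in U.
    tail-staircase : ∀ {h c} → (h ∷ c) ∈ cs → Staircase rank c
    tail-staircase {zero}       hc∈ = U↗ (∈-++⁺ˡ (∈-tailsWith⁺ cs hc∈))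
    tail-staircase {suc zero}   hc∈ = U↗ (T₁⊆U (∈-tailsWith⁺ cs hc∈))
    tail-staircase {suc (suc v)} {c} hc∈ i j ci≡1 cj≡0 with Fin.<-cmp (rank i) (rank j)
    ... | tri< i<j _ _ = i<j
    ... | tri≈ _ i≡j _ with rank-injective i≡j
    ...   | refl with trans (sym ci≡1) cj≡0
    ...     | ()
    tail-staircase {suc (suc v)} {c} hc∈ i j ci≡1 cj≡0 | tri> _ ranks≢ j<i =
      ⊥-elim (noCrossing hc∈ (proj₂ (U-lift probe∈U))
                ((suc i , ci≡1 , probe-i v i j i≢j) , (suc j , cj≡0 , probe-j v i j)))
      where
      i≢j : i ≢ j
      i≢j refl = ranks≢ refl
      probe∈U : probe v i j ∈ U
      probe∈U = U-saturated (probe-staircase v rank j<i)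

    ρ : Permutation′ (suc m)
    ρ = insert zero K ρ′

    ρ-suc : ∀ j → ρ ⟨$⟩ʳ suc j ≡ Fin.punchIn K (rank j)
    ρ-suc = insert-punchIn zero K ρ′

    staircase : ∀ {w} → w ∈ cs → Staircase (ρ ⟨$⟩ʳ_) w
    staircase {h ∷ c} w∈ zero zero h≡1 h≡0 with trans (sym h≡1) h≡0
    ... | ()
    staircase {h ∷ c} w∈ zero (suc j) refl cj≡0 =
      subst (K Fin.<_) (sym (ρ-suc j))
        (punchIn-above K (rank j) (K≤zero-under-1 j w∈ cj≡0))
    staircase {h ∷ c} w∈ (suc i) zero ci≡1 refl =
      subst (Fin._< K) (sym (ρ-suc i))
        (punchIn-below K (rank i) (one-under-0<K i w∈ ci≡1))
    staircase {h ∷ c} w∈ (suc i) (suc j) ci≡1 cj≡0 =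
      subst₂ Fin._<_ (sym (ρ-suc i)) (sym (ρ-suc j))
        (punchIn-mono-< K (rank i) (rank j) (tail-staircase w∈ i j ci≡1 cj≡0))

  extremal⇒staircase : ∀ m (cs : List (Column m)) → Admissible cs → length cs ≡ forbSize m →
                       Σ (Permutation′ m) λ ρ → ∀ {c} → c ∈ cs → Staircase (ρ ⟨$⟩ʳ_) c
  extremal⇒staircase zero    cs adm extremal = idₚ , λ { {[]} _ () }
  extremal⇒staircase (suc m) cs adm extremal =
    let open TopRowSplit (admissible-length≤ m) cs adm
        open Extremal extremal
        (ρ′ , U↗) = extremal⇒staircase m U U-admissible length-U
    in InsertTopRow.ρ cs adm extremal ρ′ U↗ , InsertTopRow.staircase cs adm extremal ρ′ U↗

  module _ {m : ℕ} where

    column : ∀ {n} → Matrix r m n → Fin n → Column m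
    column B j = Vec.tabulate (λ i → B i j)

    lookup-column : ∀ {n} (B : Matrix r m n) i j → lookup (column B j) i ≡ B i j
    lookup-column B i j = Vec.lookup∘tabulate (λ i → B i j) i

    columns : ∀ {n} → Matrix r m n → List (Column m)
    columns B = List.tabulate (column B)

    length-columns : ∀ {n} (B : Matrix r m n) → length (columns B) ≡ n
    length-columns B = length-tabulate (column B)

    column-injective : ∀ {n} (B : Matrix r m n) → Simple B → ∀ {j k} → column B j ≡ column B k → j ≡ k
    column-injective B simple {j} {k} same with j Fin.≟ k
    ... | yes j≡k = j≡k
    ... | no  j≢k = ⊥-elim (simple j k j≢k λ i →
            trans (sym (lookup-column B i j)) (trans (cong (λ w → lookup w i) same) (lookup-column B i k)))

    toℕ≡1 : ∀ (a : Fin r) → toℕ a ≡ 1 → a ≡ e₁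
    toℕ≡1 (suc zero) _ = refl

    toℕ≡0 : ∀ (a : Fin r) → toℕ a ≡ 0 → a ≡ e₀
    toℕ≡0 zero _ = refl

    columns-admissible : ∀ {n} (B : Matrix r m n) → Simple B → AvoidsI₂ B → Admissible (columns B)
    columns-admissible B simple avoids = Unique.tabulate⁺ (column-injective B simple) , noCrossing
      where
      noCrossing : ∀ {c d} → c ∈ columns B → d ∈ columns B → ¬ Crossing c d
      noCrossing c∈ d∈ ((i₁ , c₁≡1 , d₁≡0) , (i₂ , c₂≡0 , d₂≡1))
        with ∈-tabulate⁻ c∈ | ∈-tabulate⁻ d∈
      ... | j , refl | k , refl =
        avoids (i₁ , i₂ , j , k , (λ { refl → one≢zero (trans (sym c₁≡1) c₂≡0) })
                               , (λ { refl → one≢zero (trans (sym c₁≡1) d₁≡0) })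
               , entry c₁≡1 , entry d₁≡0 , entry c₂≡0 , entry d₂≡1)
        where
        entry : ∀ {i j a} → lookup (column B j) i ≡ a → toℕ (B i j) ≡ toℕ a
        entry {i} {j} eq = cong toℕ (trans (sym (lookup-column B i j)) eq)
        one≢zero : e₁ ≢ e₀
        one≢zero ()

    staircaseColumn : Fin (forbSize m) → Column m
    staircaseColumn t = List.lookup (staircases m) (Fin.cast (sym (length-staircases m)) t)

    staircaseMatrix : Matrix r m (forbSize m)
    staircaseMatrix i t = lookup (staircaseColumn t) i

    staircaseColumn-staircase : ∀ t → Staircase id (staircaseColumn t)
    staircaseColumn-staircase t = ∈-staircases⁻ m (∈-lookup (Fin.cast (sym (length-staircases m)) t))

    staircaseMatrix-simple : Simple staircaseMatrix
    staircaseMatrix-simple j k j≢k same = j≢k (cast-injective (sym (length-staircases m))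
      (lookup-injective (staircases m) (staircases-unique m) (vec-ext _ _ same)))

    staircaseMatrix-avoids : AvoidsI₂ staircaseMatrix
    staircaseMatrix-avoids (i₁ , i₂ , j₁ , j₂ , _ , _ , a , b , c , d) =
      staircase-noCrossing {c = staircaseColumn j₁} {staircaseColumn j₂}
        (staircaseColumn-staircase j₁) (staircaseColumn-staircase j₂)
        ((i₁ , toℕ≡1 _ a , toℕ≡0 _ b) , (i₂ , toℕ≡0 _ c , toℕ≡1 _ d))

    staircaseMatrix-isForb : IsForbI₂ m r (forbSize m)
    staircaseMatrix-isForb = (staircaseMatrix , staircaseMatrix-simple , staircaseMatrix-avoids)
      , λ n B simple avoids → subst (_≤ forbSize m) (length-columns B)
                                (admissible-length≤ m (columns B) (columns-admissible B simple avoids))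

    -- Every simple matrix avoiding I₂ with forbSize m columns is the staircase
    -- matrix up to row and column permutations: after sorting its rows by the
    -- ranking for which all its columns are staircases, its columns are distinct
    -- staircases for the natural order, i.e. a rearrangement of the columns of
    -- the staircase matrix.
    staircaseMatrix-unique : ∀ (B : Matrix r m (forbSize m)) → Simple B → AvoidsI₂ B → PermEquiv B staircaseMatrix
    staircaseMatrix-unique B simple avoids = ρ , τ , entries
      where
      ranking = extremal⇒staircase m (columns B) (columns-admissible B simple avoids) (length-columns B)
      ρ = proj₁ ranking
      open RowPermutation ρ

      sorted : Fin (forbSize m) → Column m
      sorted j = unpermuteRows (column B j)

      sorted∈ : ∀ j → sorted j ∈ staircases m
      sorted∈ j = ∈-staircases⁺ m (staircase-unpermuteRows {column B j} (proj₂ ranking (∈-tabulate⁺ j)))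

      τ₀ : Fin (forbSize m) → Fin (forbSize m)
      τ₀ j = Fin.cast (length-staircases m) (index (sorted∈ j))

      staircaseColumn-τ₀ : ∀ j → staircaseColumn (τ₀ j) ≡ sorted j
      staircaseColumn-τ₀ j =
        trans (cong (List.lookup (staircases m))
                    (Fin.cast-involutive (sym (length-staircases m)) (length-staircases m) _))
              (sym (lookup-index (sorted∈ j)))

      τ₀-injective : ∀ {j k} → τ₀ j ≡ τ₀ k → j ≡ k
      τ₀-injective {j} {k} same = column-injective B simple (begin
        column B j                           ≡⟨ permute-unpermute (column B j) ⟨
        permuteRows (sorted j)               ≡⟨ cong permuteRows (staircaseColumn-τ₀ j) ⟨
        permuteRows (staircaseColumn (τ₀ j)) ≡⟨ cong (permuteRows ∘ staircaseColumn) same ⟩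
        permuteRows (staircaseColumn (τ₀ k)) ≡⟨ cong permuteRows (staircaseColumn-τ₀ k) ⟩
        permuteRows (sorted k)               ≡⟨ permute-unpermute (column B k) ⟩
        column B k                           ∎)
        where open ≡-Reasoning

      τ-τ₀ : Σ (Permutation′ (forbSize m)) λ τ → ∀ j → τ ⟨$⟩ʳ j ≡ τ₀ j
      τ-τ₀ = injective⇒permutation τ₀ τ₀-injective

      τ = proj₁ τ-τ₀

      entries : ∀ i j → B i j ≡ staircaseMatrix (ρ ⟨$⟩ʳ i) (τ ⟨$⟩ʳ j)
      entries i j = sym (begin
        lookup (staircaseColumn (τ ⟨$⟩ʳ j)) (ρ ⟨$⟩ʳ i)
          ≡⟨ cong (λ t → lookup (staircaseColumn t) (ρ ⟨$⟩ʳ i)) (proj₂ τ-τ₀ j) ⟩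
        lookup (staircaseColumn (τ₀ j)) (ρ ⟨$⟩ʳ i)
          ≡⟨ cong (λ w → lookup w (ρ ⟨$⟩ʳ i)) (staircaseColumn-τ₀ j) ⟩
        lookup (sorted j) (ρ ⟨$⟩ʳ i)
          ≡⟨ lookup-unpermuteRows (column B j) (ρ ⟨$⟩ʳ i) ⟩
        lookup (column B j) (ρ ⟨$⟩ˡ (ρ ⟨$⟩ʳ i))
          ≡⟨ cong (lookup (column B j)) (inverseˡ ρ) ⟩
        lookup (column B j) i
          ≡⟨ lookup-column B i j ⟩
        B i j ∎)
        where open ≡-Reasoning

theorem4p3 : (r m : ℕ) → 2 ≤ r → 1 ≤ m →
    Σ ℕ λ n → IsForbI₂ m r n ×
    (Σ (Matrix r m n) λ A → Simple A × AvoidsI₂ A ×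
    (∀ (B : Matrix r m n) → Simple B → AvoidsI₂ B → PermEquiv B A))
theorem4p3 (suc (suc s)) m (s≤s (s≤s z≤n)) _ =
    forbSize m
  , staircaseMatrix-isForb
  , staircaseMatrix
  , staircaseMatrix-simple
  , staircaseMatrix-avoids
  , staircaseMatrix-unique
  where open ForbiddenI₂ s
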